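{- For every integer $k\ge 2$, there exists an IRC-colorable graph $G$ with $\chi_{irc}(G)=k$.
   Context: All graphs are finite, simple, undirected and connected. Private neighbors. For $S\subseteq V(G)$ and $v\in S$, $pn[v,S]=N[v]\setminus\bigcup_{u\in S\setminus\{v\}}N[u]$, where $N[\cdot]$ is the closed neighborhood. $S$ is irredundant if $pn[v,S]\ne\emptyset$ for all $v\in S$. Rainbow committees and IRC-colorings. For a proper coloring of $G$ with nonempty color classes $V_1,\dots,V_k$, a rainbow committee is a set containing exactly one vertex of each color class. An irredundance compelling coloring (IRC-coloring) is a proper coloring in which every rainbow committee is an irredundant set. $G$ is IRC-colorable if it admits an IRC-coloring. Irredundance compelling chromatic number. For an IRC-colorable $G$, $\chi_{irc}(G)$ is the maximum number of colors used by an IRC-coloring of $G$. -}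

module Defs where

open import Data.Nat using (ℕ; _≤_)
open import Data.Fin using (Fin)
open import Data.Bool using (Bool; true; false)
open import Data.Product using (Σ; ∃; ∃-syntax; _×_; _,_; proj₁)
open import Data.Empty using (⊥)
open import Data.Sum using (_⊎_)
open import Relation.Binary.PropositionalEquality using (_≡_; _≢_)

record Graph : Set where
  field
    n     : ℕ
    adj   : Fin n → Fin n → Bool
    sym   : ∀ u v → adj u v ≡ adj v u
    irrefl : ∀ v → adj v v ≡ false

open Graph public

data Reach (G : Graph) : Fin (n G) → Fin (n G) → Set where
  here : ∀ {v} → Reach G v v
  step : ∀ {u v w} → adj G u v ≡ true → Reach G v w → Reach G u w

Connected : Graph → Set
Connected G = ∀ u v → Reach G u v

InN[_] : {G : Graph} → Fin (n G) → Fin (n G) → Set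
InN[_] {G} v w = (w ≡ v) ⊎ (adj G v w ≡ true)

record ProperColoring (G : Graph) (k : ℕ) : Set where
  field
    col      : Fin (n G) → Fin k
    proper   : ∀ u v → adj G u v ≡ true → col u ≢ col v
    nonempty : ∀ (i : Fin k) → ∃[ v ] col v ≡ i

open ProperColoring public

-- A rainbow committee: one vertex from each color class, given as a choice
-- function r : Fin k → V with col (r i) ≡ i (so the committee is the image of r,
-- which has exactly one vertex of each color).
RainbowCommittee : {G : Graph} {k : ℕ} → ProperColoring G k → Set
RainbowCommittee {G} {k} c = Σ (Fin k → Fin (n G)) λ r → ∀ i → col c (r i) ≡ i

IrredundantCommittee : {G : Graph} (k : ℕ) → (Fin k → Fin (n G)) → Set
IrredundantCommittee {G} k r =
  ∀ (i : Fin k) → ∃[ w ] (InN[_] {G} (r i) w ×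
                          (∀ (j : Fin k) → j ≢ i → ¬N j w))
  where
    ¬N : Fin k → Fin (n G) → Set
    ¬N j w = InN[_] {G} (r j) w → ⊥

IsIRC : {G : Graph} {k : ℕ} → ProperColoring G k → Set
IsIRC {G} {k} c = ∀ (R : RainbowCommittee c) → IrredundantCommittee {G} k (proj₁ R)

HasIRC : Graph → ℕ → Set
HasIRC G k = Σ (ProperColoring G k) IsIRC

IRCColorable : Graph → Set
IRCColorable G = ∃[ k ] HasIRC G k

χirc≡ : Graph → ℕ → Set
χirc≡ G k = HasIRC G k × (∀ k′ → HasIRC G k′ → k′ ≤ k)

-- In an IRC-coloring, a vertex u with a neighbour x whose neighbourhood lies inside
-- that of v gets the colour of v: otherwise a rainbow committee through u, v and x
-- leaves u without a private neighbour, as u itself is seen by x and every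
-- neighbour of u by v.
-- For k colours take the vertices (j , i , b) with j , i < k and a bit b, where
-- (j , i , _) and (j′ , i′ , _) are adjacent iff j ≠ j′ and i , i′ ∈ {j , j′}.
-- Every vertex of class j is dominated by the hub (j , j , false), so an
-- IRC-coloring is constant on the k classes. Conversely, colouring by class, the
-- member v of class t of a rainbow committee has the private neighbour (j , t , b),
-- where j ≠ t is a class with pointer v ∈ {t , j} and the bit b differs from that
-- of the member of class j.
module Submission where

open import Defs hiding (sym)
open import Data.Nat using (ℕ; _≤_; suc; _*_; s≤s; z≤n)
open import Data.Product using (∃-syntax; _×_; _,_; proj₁; proj₂)
open import Data.Fin using (Fin; zero; _≟_; punchIn)
open import Data.Fin.Properties using (injective⇒≤; punchInᵢ≢i; *↔×; 2↔Bool)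
open import Data.Bool using (Bool; true; false; not)
open import Data.Bool.Properties using (not-¬)
open import Data.Empty using (⊥; ⊥-elim)
open import Data.Sum using (_⊎_; inj₁; inj₂; swap)
open import Data.Product.Function.NonDependent.Propositional using (_×-↔_)
open import Function using (_∘_)
open import Function.Bundles using (_↔_; Inverse; mk⇔)
open import Function.Properties.Inverse using (↔-refl; ↔-trans)
open import Relation.Nullary using (¬_; Dec; does; yes; no)
open import Relation.Nullary.Decidable
  using (dec-true; dec-false; does-⇔; decidable-stable; map′; _×-dec_; _⊎-dec_; ¬?)
open import Relation.Binary.Definitions using (Decidable; Symmetric)
open import Relation.Binary.PropositionalEquality
  using (_≡_; _≢_; refl; sym; trans; cong; subst; module ≡-Reasoning)

Reach-trans : ∀ {G : Graph} {u v w} → Reach G u v → Reach G v w → Reach G u w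
Reach-trans here q = q
Reach-trans (step e p) q = step e (Reach-trans p q)

module Committee {G : Graph} {k : ℕ} (c : ProperColoring G k) where

  representative : Fin k → Fin (n G)
  representative i = proj₁ (nonempty c i)

  default : RainbowCommittee c
  default = representative , proj₂ ∘ nonempty c

  insert : Fin (n G) → (Fin k → Fin (n G)) → Fin k → Fin (n G)
  insert v r i with i ≟ col c v
  ... | yes _ = v
  ... | no _ = r i

  insert-rainbow : ∀ v {r} → (∀ i → col c (r i) ≡ i) → ∀ i → col c (insert v r i) ≡ i
  insert-rainbow v hr i with i ≟ col c v
  ... | yes i≡cv = sym i≡cv
  ... | no _ = hr i

  insert-here : ∀ v r → insert v r (col c v) ≡ v
  insert-here v r with col c v ≟ col c v
  ... | yes _ = refl
  ... | no cv≢cv = ⊥-elim (cv≢cv refl)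

  insert-there : ∀ v r {i} → i ≢ col c v → insert v r i ≡ r i
  insert-there v r {i} i≢cv with i ≟ col c v
  ... | yes i≡cv = ⊥-elim (i≢cv i≡cv)
  ... | no _ = refl

  include : Fin (n G) → RainbowCommittee c → RainbowCommittee c
  include v (r , hr) = insert v r , insert-rainbow v hr

dominated⇒sameColour : ∀ {G k} (c : ProperColoring G k) → IsIRC c →
  ∀ u v x → adj G u x ≡ true → (∀ y → adj G u y ≡ true → adj G v y ≡ true) →
  col c u ≡ col c v
dominated⇒sameColour {G} c irc u v x ux N⊆ =
  decidable-stable (col c u ≟ col c v) noPrivateNeighbour
  where
  open Committee c
  cx≢cu : col c x ≢ col c u
  cx≢cu = proper c u x ux ∘ sym
  cx≢cv : col c x ≢ col c v
  cx≢cv = proper c v x (N⊆ x ux) ∘ sym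
  InN-subst : ∀ {a b w} → a ≡ b → InN[_] {G} a w → InN[_] {G} b w
  InN-subst {w = w} = subst (λ z → InN[_] {G} z w)
  noPrivateNeighbour : col c u ≢ col c v → ⊥
  noPrivateNeighbour cu≢cv = private⊥ (irc (include u (include v (include x default))) (col c u))
    where
    r = insert u (insert v (insert x representative))
    r-u : r (col c u) ≡ u
    r-u = insert-here u _
    r-v : r (col c v) ≡ v
    r-v = trans (insert-there u _ (cu≢cv ∘ sym)) (insert-here v _)
    r-x : r (col c x) ≡ x
    r-x = trans (insert-there u _ cx≢cu) (trans (insert-there v _ cx≢cv) (insert-here x _))
    private⊥ : ∃[ w ] (InN[_] {G} (r (col c u)) w ×
                        (∀ j → j ≢ col c u → InN[_] {G} (r j) w → ⊥)) → ⊥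
    private⊥ (w , w∈N[u] , priv) with InN-subst r-u w∈N[u]
    ... | inj₁ refl =
      priv (col c x) cx≢cu (InN-subst (sym r-x) (inj₂ (trans (Graph.sym G x u) ux)))
    ... | inj₂ uw = priv (col c v) (cu≢cv ∘ sym) (InN-subst (sym r-v) (inj₂ (N⊆ w uw)))

colours≤ : ∀ {G k m} (c : ProperColoring G k) (f : Fin (n G) → Fin m) (g : Fin m → Fin k) →
  (∀ v → col c v ≡ g (f v)) → k ≤ m
colours≤ c f g factors = injective⇒≤ {f = f ∘ representative} injective
  where
  open Committee c using (representative)
  injective : ∀ {i j} → f (representative i) ≡ f (representative j) → i ≡ j
  injective {i} {j} eq = begin
    i                             ≡⟨ sym (proj₂ (nonempty c i)) ⟩
    col c (representative i)      ≡⟨ factors _ ⟩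
    g (f (representative i))      ≡⟨ cong g eq ⟩
    g (f (representative j))      ≡⟨ sym (factors _) ⟩
    col c (representative j)      ≡⟨ proj₂ (nonempty c j) ⟩
    j                             ∎
    where open ≡-Reasoning

module RelationGraph {n : ℕ} {V : Set} (enum : Fin n ↔ V) {_~_ : V → V → Set}
                     (_~?_ : Decidable _~_) (~-sym : Symmetric _~_) (~-irrefl : ∀ v → ¬ v ~ v) where

  open Inverse enum public using (to; from) renaming (strictlyInverseˡ to to-from)

  graph : Graph
  graph = record
    { n = n
    ; adj = λ x y → does (to x ~? to y)
    ; sym = λ x y → does-⇔ (mk⇔ ~-sym ~-sym) (to x ~? to y) (to y ~? to x)
    ; irrefl = λ x → dec-false (to x ~? to x) (~-irrefl (to x))
    }

  adj⇒~ : ∀ x y → adj graph x y ≡ true → to x ~ to y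
  adj⇒~ x y e with to x ~? to y
  ... | yes x~y = x~y

  ~⇒adj : ∀ x y → to x ~ to y → adj graph x y ≡ true
  ~⇒adj x y = dec-true (to x ~? to y)

  ~⇒adj-fromˡ : ∀ s y → s ~ to y → adj graph (from s) y ≡ true
  ~⇒adj-fromˡ s y = ~⇒adj (from s) y ∘ subst (_~ to y) (sym (to-from s))

  ~⇒adj-fromʳ : ∀ x t → to x ~ t → adj graph x (from t) ≡ true
  ~⇒adj-fromʳ x t = ~⇒adj x (from t) ∘ subst (to x ~_) (sym (to-from t))

module Witness (m : ℕ) where

  K : ℕ
  K = suc (suc m)

  Vertex : Set
  Vertex = Fin K × Fin K × Bool

  class : Vertex → Fin K
  class = proj₁

  pointer : Vertex → Fin K
  pointer = proj₁ ∘ proj₂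

  bit : Vertex → Bool
  bit = proj₂ ∘ proj₂

  hub : Fin K → Vertex
  hub j = j , j , false

  _∈⟨_,_⟩ : Fin K → Fin K → Fin K → Set
  i ∈⟨ j , j′ ⟩ = i ≡ j ⊎ i ≡ j′

  record _~_ (v w : Vertex) : Set where
    constructor adjacent
    field
      class≢   : class v ≢ class w
      pointerˡ : pointer v ∈⟨ class v , class w ⟩
      pointerʳ : pointer w ∈⟨ class v , class w ⟩

  _~?_ : Decidable _~_
  v ~? w = map′ (λ (j≢ , l , r) → adjacent j≢ l r) (λ (adjacent j≢ l r) → j≢ , l , r)
    (¬? (class v ≟ class w) ×-dec pointer∈? v ×-dec pointer∈? w)
    where
    pointer∈? : ∀ u → Dec (pointer u ∈⟨ class v , class w ⟩)
    pointer∈? u = (pointer u ≟ class v) ⊎-dec (pointer u ≟ class w)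

  ~-sym : Symmetric _~_
  ~-sym (adjacent j≢ l r) = adjacent (j≢ ∘ sym) (swap r) (swap l)

  ~-irrefl : ∀ v → ¬ v ~ v
  ~-irrefl _ (adjacent j≢ _ _) = j≢ refl

  enum : Fin (K * (K * 2)) ↔ Vertex
  enum = ↔-trans *↔× (↔-refl ×-↔ ↔-trans *↔× (↔-refl ×-↔ 2↔Bool))

  open RelationGraph enum _~?_ ~-sym ~-irrefl public

  colouring : ProperColoring graph K
  colouring = record
    { col = class ∘ to
    ; proper = λ x y → _~_.class≢ ∘ adj⇒~ x y
    ; nonempty = λ j → from (hub j) , cong class (to-from (hub j))
    }

  partner : Vertex → Fin K
  partner (j , i , _) with i ≟ j
  ... | yes _ = punchIn j zero
  ... | no _ = i

  partner≢class : ∀ v → partner v ≢ class v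
  partner≢class (j , i , _) with i ≟ j
  ... | yes _ = punchInᵢ≢i j zero
  ... | no i≢j = i≢j

  ~-partner : ∀ v {i} b → i ∈⟨ class v , partner v ⟩ → v ~ (partner v , i , b)
  ~-partner v@(j , i , _) b i∈ = adjacent (partner≢class v ∘ sym) pointer∈ i∈
    where
    pointer∈ : i ∈⟨ j , partner v ⟩
    pointer∈ with i ≟ j
    ... | yes i≡j = inj₁ i≡j
    ... | no _ = inj₂ refl

  ~⇒hub~ : ∀ {v y} → v ~ y → hub (class v) ~ y
  ~⇒hub~ (adjacent j≢ _ r) = adjacent j≢ (inj₁ refl) r

  isIRC : IsIRC colouring
  isIRC (r , hr) t = from w , inj₂ (~⇒adj-fromʳ (r t) w (~-partner v b (inj₁ refl))) , private-w
    where
    v = to (r t)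
    j = partner v
    b = not (bit (to (r j)))
    w = (j , class v , b)
    private-w : ∀ l → l ≢ t → InN[_] {graph} (r l) (from w) → ⊥
    private-w l l≢t (inj₁ w≡rl) =
      not-¬ (sym (cong (bit ∘ to ∘ r) j≡l)) (sym (cong bit w≡to-rl))
      where
      w≡to-rl : w ≡ to (r l)
      w≡to-rl = trans (sym (to-from w)) (cong to w≡rl)
      j≡l : j ≡ l
      j≡l = trans (cong class w≡to-rl) (hr l)
    private-w l l≢t (inj₂ e)
      with _~_.pointerʳ (subst (to (r l) ~_) (to-from w) (adj⇒~ (r l) (from w) e))
    ... | inj₁ t≡l = l≢t (sym (trans (sym (hr t)) (trans t≡l (hr l))))
    ... | inj₂ t≡j = partner≢class v (sym t≡j)

  colours≤K : ∀ k → HasIRC graph k → k ≤ K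
  colours≤K k (c , irc) = colours≤ c (class ∘ to) (col c ∘ from ∘ hub) sameAsHub
    where
    sameAsHub : ∀ x → col c x ≡ col c (from (hub (class (to x))))
    sameAsHub x = dominated⇒sameColour c irc x _ (from (partner (to x) , class (to x) , false))
      (~⇒adj-fromʳ x _ (~-partner (to x) false (inj₁ refl)))
      (λ y → ~⇒adj-fromˡ _ y ∘ ~⇒hub~ ∘ adj⇒~ x y)

  connected : Connected graph
  connected x y =
    step (toHub x) (Reach-trans (hubs (partner (to x)) (partner (to y)))
      (step (trans (Graph.sym graph (from (hub (partner (to y)))) y) (toHub y)) here))
    where
    toHub : ∀ x → adj graph x (from (hub (partner (to x)))) ≡ true
    toHub x = ~⇒adj-fromʳ x _ (~-partner (to x) false (inj₂ refl))
    hubs : ∀ j j′ → Reach graph (from (hub j)) (from (hub j′))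
    hubs j j′ with j ≟ j′
    ... | yes refl = here
    ... | no j≢j′ = step (~⇒adj-fromˡ (hub j) (from (hub j′))
                      (subst (hub j ~_) (sym (to-from (hub j′)))
                        (adjacent j≢j′ (inj₁ refl) (inj₂ refl)))) here

theorem7 : ∀ (k : ℕ) → 2 ≤ k →
    ∃[ G ] (Connected G × IRCColorable G × χirc≡ G k)
theorem7 (suc (suc m)) (s≤s (s≤s z≤n)) =
  graph , connected , (K , colouring , isIRC) , (colouring , isIRC) , colours≤K
  where open Witness m
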